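{- Let $C$ be a color map on the triangular lattice of size $n$, let $x\in T_n$ and integers $r,s\ge0$ with $(r,s)\ne(0,0)$ be such that all points $x+u+v\xi$, $0\le u\le r$, $0\le v\le s$, lie in $T_n$, and let $L[r,s,x]$ be the set of edges having both endpoints in $\{x+u+v\xi: 0\le u\le r,\ 0\le v\le s\}$. Suppose that the edges $[x+u-1,x+u]$, $1\le u\le r$, have color $1$ and the edges $[x+v\xi,x+(v+1)\xi]$, $0\le v\le s-1$, have color $0$. Then every edge of $L[r,s,x]$ parallel to $\bar\xi$ has color $3$, and the colors of all edges of $L[r,s,x]$ are thereby uniquely determined.
   Context: Let $\xi=e^{i\pi/3}$ and $T_n=\{r+s\xi:\ r,s\in\mathbb{Z}_{\ge0},\ r+s\le n\}$. Edges are the segments $[z,z+w]$ with $z,z+w\in T_n$, $w\in\{1,\xi,\bar\xi\}$; faces are the unit triangles with vertices in $T_n$. A color map is a map $C$ from edges to $\{0,1,3,m\}$ such that for every face the colors of its three edges read in clockwise order form, up to cyclic rotation, one of $(0,0,0)$, $(1,1,1)$, $(1,0,3)$, $(0,1,m)$. -}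

module Defs where

open import Data.Nat using (ℕ; zero; suc; _+_; _≤_; _<_)
open import Data.Product using (_×_; _,_; Σ; ∃; ∃-syntax)
open import Relation.Binary.PropositionalEquality using (_≡_)
open import Relation.Nullary using (¬_)

-- Points of the lattice: (a , b) stands for a + b·ξ, ξ = e^{iπ/3}.
Point : Set
Point = ℕ × ℕ

InT : ℕ → Point → Set
InT n (a , b) = a + b ≤ n

data Color : Set where
  c0 c1 c3 cm : Color

data Dir : Set where
  one xi xibar : Dir

-- An edge is coded by (a , b , d):
--   (a , b , one)   = [ (a,b) , (a+1,b) ]        = [z , z+1],  z = a+bξ
--   (a , b , xi)    = [ (a,b) , (a,b+1) ]        = [z , z+ξ],  z = a+bξ
--   (a , b , xibar) = [ (a,b+1) , (a+1,b) ]      = [z , z+ξ̄], z = a+(b+1)ξ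
-- In all three cases both endpoints lie in T_n iff a + b + 1 ≤ n.
Edge : Set
Edge = ℕ × ℕ × Dir

endpoints : Edge → Point × Point
endpoints (a , b , one)   = (a , b) , (suc a , b)
endpoints (a , b , xi)    = (a , b) , (a , suc b)
endpoints (a , b , xibar) = (a , suc b) , (suc a , b)

-- Colourings are modelled as total functions on edge codes; only the
-- values on edges of T_n are constrained/used.
Coloring : Set
Coloring = ℕ → ℕ → Dir → Color

Triple : Set
Triple = Color × Color × Color

data Allowed : Triple → Set where
  a000 : Allowed (c0 , c0 , c0)
  a111 : Allowed (c1 , c1 , c1)
  a103 : Allowed (c1 , c0 , c3)
  a01m : Allowed (c0 , c1 , cm)

data CycRot : Triple → Triple → Set where
  rot0 : ∀ {p q r} → CycRot (p , q , r) (p , q , r)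
  rot1 : ∀ {p q r} → CycRot (q , r , p) (p , q , r)
  rot2 : ∀ {p q r} → CycRot (r , p , q) (p , q , r)

ValidFace : Triple → Set
ValidFace t = ∃[ t' ] (Allowed t' × CycRot t t')

-- Clockwise colours of the faces.
-- Upward face {z, z+1, z+ξ}, z = a+bξ, clockwise z → z+ξ → z+1 → z:
upFace : Coloring → ℕ → ℕ → Triple
upFace C a b = C a b xi , C a b xibar , C a b one

-- Downward face {z+ξ, z+1+ξ, z+1}, z = a+bξ, clockwise
-- z+ξ → z+1+ξ → z+1 → z+ξ:
downFace : Coloring → ℕ → ℕ → Triple
downFace C a b = C a (suc b) one , C (suc a) b xi , C a b xibar

IsColorMap : ℕ → Coloring → Set
IsColorMap n C =
  (∀ a b → suc (a + b) ≤ n → ValidFace (upFace C a b)) ×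
  (∀ a b → suc (suc (a + b)) ≤ n → ValidFace (downFace C a b))

InPar : Point → ℕ → ℕ → Point → Set
InPar (x₁ , x₂) r s (a , b) =
  ∃[ u ] ∃[ v ] (u ≤ r × v ≤ s × a ≡ x₁ + u × b ≡ x₂ + v)

InL : Point → ℕ → ℕ → Edge → Set
InL x r s e = InPar x r s (Data.Product.proj₁ (endpoints e))
            × InPar x r s (Data.Product.proj₂ (endpoints e))
  where import Data.Product

-- Hypotheses on the boundary edges:
--  [x+u-1, x+u], 1 ≤ u ≤ r, colour 1 (coded as (x₁+u' , x₂ , one), u' = u-1 < r);
--  [x+vξ, x+(v+1)ξ], 0 ≤ v ≤ s-1, colour 0.
BoundaryHyp : Coloring → Point → ℕ → ℕ → Set
BoundaryHyp C (x₁ , x₂) r s =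
  (∀ u → u < r → C (x₁ + u) x₂ one ≡ c1) ×
  (∀ v → v < s → C x₁ (x₂ + v) xi ≡ c0)

ParInT : ℕ → Point → ℕ → ℕ → Set
ParInT n (x₁ , x₂) r s = ∀ u v → u ≤ r → v ≤ s → InT n (x₁ + u , x₂ + v)

{-# OPTIONS --safe #-}
-- A unit rhombus {z, z+1, z+ξ, z+1+ξ} is an up face and a down face glued along
-- their ξ̄-edge. If its bottom edge has colour 1 and its left edge colour 0, the
-- up face reads (0, ?, 1) clockwise, which only the rotation (0, 3, 1) of
-- (1, 0, 3) allows; the down face then reads (?, ?, 3), which forces (1, 0, 3),
-- so the top edge has colour 1 and the right edge colour 0. Sweeping the
-- parallelogram rhombus by rhombus from the two boundary sides, every edge of
-- L[r,s,x] gets colour 1, 0 or 3 according to its direction 1, ξ or ξ̄, whatever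
-- the colour map; this gives both claims at once.
module Submission where

open import Defs
open import Data.Nat using (ℕ; zero; suc; _+_; _≤_; _<_)
open import Data.Nat.Properties using (+-suc; +-identityʳ; +-cancelˡ-≡; ≤-trans; n≤1+n; <⇒≤)
open import Data.Product using (_×_; _,_; proj₁; proj₂)
open import Relation.Binary.PropositionalEquality
  using (_≡_; refl; sym; trans; subst; cong; cong₂; module ≡-Reasoning)
open import Relation.Nullary using (¬_)

validFace-c0-q-c1⇒q≡c3 : ∀ {p q r} → p ≡ c0 → r ≡ c1 → ValidFace (p , q , r) → q ≡ c3
validFace-c0-q-c1⇒q≡c3 refl refl (_ , a103 , rot1) = refl
validFace-c0-q-c1⇒q≡c3 refl refl (_ , a000 , ())
validFace-c0-q-c1⇒q≡c3 refl refl (_ , a111 , ())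
validFace-c0-q-c1⇒q≡c3 refl refl (_ , a01m , ())

validFace-p-q-c3⇒p≡c1×q≡c0 : ∀ {p q r} → r ≡ c3 → ValidFace (p , q , r) → p ≡ c1 × q ≡ c0
validFace-p-q-c3⇒p≡c1×q≡c0 refl (_ , a103 , rot0) = refl , refl
validFace-p-q-c3⇒p≡c1×q≡c0 refl (_ , a000 , ())
validFace-p-q-c3⇒p≡c1×q≡c0 refl (_ , a111 , ())
validFace-p-q-c3⇒p≡c1×q≡c0 refl (_ , a01m , ())

-- Edges of the rhombus at (a , b): bottom (a , b , one), left (a , b , xi),
-- diagonal (a , b , xibar), top (a , suc b , one), right (suc a , b , xi).
RhombusRule : Coloring → ℕ → ℕ → Set
RhombusRule C a b =
  C a b one ≡ c1 → C a b xi ≡ c0 →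
  C a b xibar ≡ c3 × C a (suc b) one ≡ c1 × C (suc a) b xi ≡ c0

colorMap⇒rhombusRule : ∀ {n} C a b → IsColorMap n C → suc (suc (a + b)) ≤ n →
                       RhombusRule C a b
colorMap⇒rhombusRule C a b (up , down) rhombus≤n bottom≡c1 left≡c0 =
  diagonal≡c3 , validFace-p-q-c3⇒p≡c1×q≡c0 diagonal≡c3 (down a b rhombus≤n)
  where
  diagonal≡c3 : C a b xibar ≡ c3
  diagonal≡c3 = validFace-c0-q-c1⇒q≡c3 left≡c0 bottom≡c1 (up a b (≤-trans (n≤1+n _) rhombus≤n))

shift : Coloring → Point → Coloring
shift C (x₁ , x₂) u v = C (x₁ + u) (x₂ + v)

rhombusRule-shift : ∀ C x₁ x₂ u v → RhombusRule C (x₁ + u) (x₂ + v) →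
                    RhombusRule (shift C (x₁ , x₂)) u v
rhombusRule-shift C x₁ x₂ u v rule rewrite +-suc x₁ u | +-suc x₂ v = rule

boundaryHyp-shift : ∀ C x₁ x₂ r s → BoundaryHyp C (x₁ , x₂) r s →
                    BoundaryHyp (shift C (x₁ , x₂)) (0 , 0) r s
boundaryHyp-shift C x₁ x₂ r s (bottom , left) =
  (λ u u<r → subst (λ b → C (x₁ + u) b one ≡ c1) (sym (+-identityʳ x₂)) (bottom u u<r)) ,
  (λ v v<s → subst (λ a → C a (x₂ + v) xi ≡ c0) (sym (+-identityʳ x₁)) (left v v<s))

module Parallelogram (D : Coloring) (r s : ℕ)
  (rule : ∀ u v → u < r → v < s → RhombusRule D u v)
  (boundary : BoundaryHyp D (0 , 0) r s) where

  xi≡c0 : ∀ u v → u ≤ r → v < s → D u v xi ≡ c0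
  one≡c1 : ∀ u v → u < r → v ≤ s → D u v one ≡ c1
  rhombus : ∀ u v → u < r → v < s →
            D u v xibar ≡ c3 × D u (suc v) one ≡ c1 × D (suc u) v xi ≡ c0

  xi≡c0 zero    v _   v<s = proj₂ boundary v v<s
  xi≡c0 (suc u) v u<r v<s = proj₂ (proj₂ (rhombus u v u<r v<s))

  one≡c1 u zero    u<r _   = proj₁ boundary u u<r
  one≡c1 u (suc v) u<r v<s = proj₁ (proj₂ (rhombus u v u<r v<s))

  rhombus u v u<r v<s = rule u v u<r v<s (one≡c1 u v u<r (<⇒≤ v<s)) (xi≡c0 u v (<⇒≤ u<r) v<s)

  xibar≡c3 : ∀ u v → u < r → v < s → D u v xibar ≡ c3
  xibar≡c3 u v u<r v<s = proj₁ (rhombus u v u<r v<s)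

parInT⇒rhombus≤n : ∀ {n r s u v} x₁ x₂ → ParInT n (x₁ , x₂) r s → u < r → v < s →
                   suc (suc (x₁ + u + (x₂ + v))) ≤ n
parInT⇒rhombus≤n {n} {u = u} {v} x₁ x₂ par u<r v<s =
  subst (_≤ n) corner (par (suc u) (suc v) u<r v<s)
  where
  open ≡-Reasoning
  corner : x₁ + suc u + (x₂ + suc v) ≡ suc (suc (x₁ + u + (x₂ + v)))
  corner = begin
    x₁ + suc u + (x₂ + suc v)      ≡⟨ cong₂ _+_ (+-suc x₁ u) (+-suc x₂ v) ⟩
    suc (x₁ + u) + suc (x₂ + v)    ≡⟨ cong suc (+-suc (x₁ + u) (x₂ + v)) ⟩
    suc (suc (x₁ + u + (x₂ + v)))  ∎

suc-offset⇒< : ∀ x u u' r → suc (x + u) ≡ x + u' → u' ≤ r → u < r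
suc-offset⇒< x u u' r eq u'≤r =
  subst (_≤ r) (sym (+-cancelˡ-≡ x (suc u) u' (trans (+-suc x u) eq))) u'≤r

canonicalColor : Dir → Color
canonicalColor one   = c1
canonicalColor xi    = c0
canonicalColor xibar = c3

colorMap⇒L-canonical : ∀ {n r s} C x → IsColorMap n C → ParInT n x r s → BoundaryHyp C x r s →
                       ∀ a b d → InL x r s (a , b , d) → C a b d ≡ canonicalColor d
colorMap⇒L-canonical {n} {r} {s} C (x₁ , x₂) isCM par hyp = onL
  where
  open Parallelogram (shift C (x₁ , x₂)) r s
    (λ u v u<r v<s → rhombusRule-shift C x₁ x₂ u v
                       (colorMap⇒rhombusRule C (x₁ + u) (x₂ + v) isCM (parInT⇒rhombus≤n x₁ x₂ par u<r v<s)))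
    (boundaryHyp-shift C x₁ x₂ r s hyp)

  onL : ∀ a b d → InL (x₁ , x₂) r s (a , b , d) → C a b d ≡ canonicalColor d
  onL _ _ one ((u , v , _ , v≤s , refl , refl) , (u' , _ , u'≤r , _ , e , _)) =
    one≡c1 u v (suc-offset⇒< x₁ u u' r e u'≤r) v≤s
  onL _ _ xi ((u , v , u≤r , _ , refl , refl) , (_ , v' , _ , v'≤s , _ , e)) =
    xi≡c0 u v u≤r (suc-offset⇒< x₂ v v' s e v'≤s)
  onL _ _ xibar ((u , v , _ , v≤s , refl , e₂) , (u' , v' , u'≤r , _ , e₁ , refl)) =
    xibar≡c3 u v' (suc-offset⇒< x₁ u u' r e₁ u'≤r) (suc-offset⇒< x₂ v' v s e₂ v≤s)

lemma4p2 : (n : ℕ) (C : Coloring) → IsColorMap n C →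
    (x : Point) (r s : ℕ) → InT n x → ¬ (r ≡ 0 × s ≡ 0) →
    ParInT n x r s → BoundaryHyp C x r s →
    (∀ a b → InL x r s (a , b , xibar) → C a b xibar ≡ c3) ×
    ((C' : Coloring) → IsColorMap n C' → BoundaryHyp C' x r s →
      ∀ a b d → InL x r s (a , b , d) → C' a b d ≡ C a b d)
lemma4p2 n C isCM x r s _ _ par hyp =
  (λ a b → colorMap⇒L-canonical C x isCM par hyp a b xibar) ,
  λ C' isCM' hyp' a b d inL →
    trans (colorMap⇒L-canonical C' x isCM' par hyp' a b d inL)
          (sym (colorMap⇒L-canonical C x isCM par hyp a b d inL))
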